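{- Let $k\ge2$. The families $\mathcal{F}_R^Q$, for disjoint nonempty symmetric $Q,R\subseteq\mathbb{Z}_{2k+1}$, are exactly the minimal families of 2-terminal graphs such that $K_2\in\mathcal{F}_{\mathbf{s}(1)}^X$ for every nonempty symmetric $X\subseteq\bar{\mathbf{s}}(1)$, and the following two constructions hold for all disjoint nonempty symmetric $Q,R$: (1) for all symmetric sets $S,T$ with $R=S\cap T$, $Q\cap(T\setminus S)\neq\emptyset$ and $Q\cap(S\setminus T)\neq\emptyset$, if $G_1\in\mathcal{F}_S^{Q\cap(T\setminus S)}$ and $G_2\in\mathcal{F}_T^{Q\cap(S\setminus T)}$ then $G_1\,\|\,G_2\in\mathcal{F}_R^Q$; (2) for all symmetric sets $S,T$ with $R=S+T$, $Q_T\ne\emptyset$ and $Q_S\ne\emptyset$, if $G_1\in\mathcal{F}_S^{Q_T}$ and $G_2\in\mathcal{F}_T^{Q_S}$ then $G_1+G_2\in\mathcal{F}_R^Q$.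
   Context: $V(C_{2k+1})=\mathbb{Z}_{2k+1}$, $u\sim v$ iff $u-v=\pm1$; a $C_{2k+1}$-colouring is a map $\phi:V(G)\to\mathbb{Z}_{2k+1}$ with $\phi(u)-\phi(v)=\pm1$ on every edge. Symmetric means closed under negation; $\mathbf{s}(1)=\{1,-1\}$, $\bar{\mathbf{s}}(1)=\mathbb{Z}_{2k+1}\setminus\{1,-1\}$. For $S,T\subseteq\mathbb{Z}_{2k+1}$, $S+T=\{x+y:x\in S,y\in T\}$ and $Q_S=\{x\in\mathbb{Z}_{2k+1}:(x+S)\cap Q\ne\emptyset\}$. A 2-terminal graph $(G,s,t)$ has two distinct distinguished vertices; serial sum $(G_1,s_1,t_1)+(G_2,s_2,t_2)$ identifies $t_1$ with $s_2$ (terminals $s_1,t_2$); parallel sum $G_1\,\|\,G_2$ identifies $s_1$ with $s_2$ and $t_1$ with $t_2$. 2-terminal series-parallel graphs are built from single edges ($K_2$) by these sums. For nonempty $S$, $(G,s,t)$ is $S$-forcing if $S=\{x:\exists$ a $C_{2k+1}$-colouring $\phi$ of $G$ with $\phi(s)=0,\phi(t)=x\}$, minimally $S$-forcing if moreover no proper subgraph $(G',s,t)$ is $S$-forcing. For disjoint nonempty symmetric $S,T$, $\mathcal{F}_S^T$ is the family of minimally $S$-forcing 2-terminal series-parallel graphs $(G,s,t)$ such that for every edge $e$ there are $x\in T$ and a $C_{2k+1}$-colouring $\phi$ of $G-e$ with $\phi(s)=0,\phi(t)=x$. -}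

module Defs where

open import Level using (0ℓ)
open import Data.Nat using (ℕ; suc; _+_; _∸_)
open import Data.Nat.DivMod using (_mod_)
open import Data.Fin using (Fin; toℕ)
open import Data.Fin.Properties using (any?)
open import Data.Fin.Subset using (Subset; _∈_; _∩_; _∪_; _─_; ∁; ⁅_⁆; Nonempty; _⊆_)
open import Data.Fin.Subset.Properties using (_∈?_)
open import Data.Vec using (tabulate)
open import Data.Bool using (Bool; true; false; not; _∧_; T)
open import Data.Bool.Properties using (T-irrelevant)
import Data.Bool.Properties
import Function.Bundles
import Data.Bool as B
open import Data.Unit using (⊤; tt)
open import Data.Empty using (⊥; ⊥-elim)
open import Data.Product using (Σ; ∃; _×_; _,_; proj₁; proj₂)
open import Data.Sum using (_⊎_; inj₁; inj₂)
import Data.Sum.Properties as SumP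
open import Function using (_∘_)
open import Function.Bundles using (_↔_; Inverse)
open import Relation.Nullary using (¬_; Dec; yes; no; does)
open import Relation.Nullary.Decidable using (⌊_⌋; _×-dec_)
open import Relation.Binary using (DecidableEquality)
open import Relation.Binary.PropositionalEquality using (_≡_; _≢_; refl; cong)

-- The cycle C_{2k+1}: vertices Z_{2k+1} = Fin (2k+1), arithmetic mod 2k+1

Z : ℕ → Set
Z k = Fin (suc (k + k))

module ZOps (k : ℕ) where

  m : ℕ
  m = suc (k + k)

  zeroZ : Z k
  zeroZ = 0 mod m

  oneZ : Z k
  oneZ = 1 mod m

  infixl 6 _⊕_
  _⊕_ : Z k → Z k → Z k
  a ⊕ b = (toℕ a + toℕ b) mod m

  negZ : Z k → Z k
  negZ a = (m ∸ toℕ a) mod m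

  Adj : Z k → Z k → Set
  Adj a b = (a ≡ b ⊕ oneZ) ⊎ (b ≡ a ⊕ oneZ)

  Symmetric : Subset (suc (k + k)) → Set
  Symmetric S = ∀ x → x ∈ S → negZ x ∈ S

  Disjoint : Subset (suc (k + k)) → Subset (suc (k + k)) → Set
  Disjoint S T = ∀ x → x ∈ S → x ∈ T → ⊥

  s1 : Subset (suc (k + k))
  s1 = ⁅ oneZ ⁆ ∪ ⁅ negZ oneZ ⁆

  s̄1 : Subset (suc (k + k))
  s̄1 = ∁ s1

  _⊞_ : Subset (suc (k + k)) → Subset (suc (k + k)) → Subset (suc (k + k))
  S ⊞ T = tabulate λ z →
    ⌊ any? (λ x → any? (λ y → (x ∈? S) ×-dec ((y ∈? T) ×-dec (z Data.Fin.≟ x ⊕ y)))) ⌋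

  _⟨_⟩ : Subset (suc (k + k)) → Subset (suc (k + k)) → Subset (suc (k + k))
  Q ⟨ S ⟩ = tabulate λ x → ⌊ any? (λ y → (y ∈? S) ×-dec ((x ⊕ y) ∈? Q)) ⌋

record TGraph : Set₁ where
  field
    V    : Set
    E    : Set
    ends : E → V × V
    s t  : V
    s≢t  : s ≢ t
    _≟V_ : DecidableEquality V

open TGraph public

decSub : {A : Set} → DecidableEquality A → (P : A → Bool) → DecidableEquality (Σ A (T ∘ P))
decSub _≟_ P (a , p) (b , q) with a ≟ b
... | no ne = no (λ eq → ne (cong proj₁ eq))
... | yes refl = yes (cong (a ,_) (T-irrelevant p q))

notDoes : {A : Set} (_≟_ : DecidableEquality A) {a b : A} → a ≢ b → T (not (does (a ≟ b)))
notDoes _≟_ {a} {b} ne with a ≟ b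
... | yes eq = ⊥-elim (ne eq)
... | no _ = tt

K2 : TGraph
K2 = record { V = Bool ; E = ⊤ ; ends = λ _ → (false , true) ; s = false ; t = true
            ; s≢t = λ () ; _≟V_ = B._≟_ }

-- serial sum: identify t1 with s2; terminals s1, t2
module Serial (G₁ G₂ : TGraph) where
  open TGraph G₁ renaming (V to V₁; E to E₁; ends to ends₁; s to s₁; t to t₁; _≟V_ to _≟₁_)
  open TGraph G₂ renaming (V to V₂; E to E₂; ends to ends₂; s to s₂; t to t₂; s≢t to s≢t₂; _≟V_ to _≟₂_)

  P₂ : V₂ → Bool
  P₂ v = not (does (v ≟₂ s₂))

  W : Set
  W = V₁ ⊎ Σ V₂ (T ∘ P₂)

  emb : V₂ → W
  emb v with v ≟₂ s₂
  ... | yes _ = inj₁ t₁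
  ... | no ne = inj₂ (v , notDoes _≟₂_ ne)

  graph : TGraph
  graph = record
    { V = W
    ; E = E₁ ⊎ E₂
    ; ends = λ { (inj₁ e) → (inj₁ (proj₁ (ends₁ e)) , inj₁ (proj₂ (ends₁ e)))
               ; (inj₂ e) → (emb (proj₁ (ends₂ e)) , emb (proj₂ (ends₂ e))) }
    ; s = inj₁ s₁
    ; t = inj₂ (t₂ , notDoes _≟₂_ (λ eq → s≢t₂ (Relation.Binary.PropositionalEquality.sym eq)))
    ; s≢t = λ ()
    ; _≟V_ = SumP.≡-dec _≟₁_ (decSub _≟₂_ P₂)
    }

-- parallel sum: identify s1 with s2 and t1 with t2; terminals s1, t1
module Parallel (G₁ G₂ : TGraph) where
  open TGraph G₁ renaming (V to V₁; E to E₁; ends to ends₁; s to s₁; t to t₁; s≢t to s≢t₁; _≟V_ to _≟₁_)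
  open TGraph G₂ renaming (V to V₂; E to E₂; ends to ends₂; s to s₂; t to t₂; _≟V_ to _≟₂_)

  P₂ : V₂ → Bool
  P₂ v = not (does (v ≟₂ s₂)) ∧ not (does (v ≟₂ t₂))

  W : Set
  W = V₁ ⊎ Σ V₂ (T ∘ P₂)

  emb : V₂ → W
  emb v with v ≟₂ s₂
  ... | yes _ = inj₁ s₁
  ... | no ne with v ≟₂ t₂
  ...   | yes _ = inj₁ t₁
  ...   | no ne' = inj₂ (v , Data.Bool.Properties.T-∧ {not (does (v ≟₂ s₂))} .Function.Bundles.Equivalence.from (notDoes _≟₂_ ne , notDoes _≟₂_ ne'))

  inj₁-inj : {A B : Set} {a b : A} → inj₁ {B = B} a ≡ inj₁ b → a ≡ b
  inj₁-inj refl = refl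

  graph : TGraph
  graph = record
    { V = W
    ; E = E₁ ⊎ E₂
    ; ends = λ { (inj₁ e) → (inj₁ (proj₁ (ends₁ e)) , inj₁ (proj₂ (ends₁ e)))
               ; (inj₂ e) → (emb (proj₁ (ends₂ e)) , emb (proj₂ (ends₂ e))) }
    ; s = inj₁ s₁
    ; t = inj₁ t₁
    ; s≢t = λ eq → s≢t₁ (inj₁-inj eq)
    ; _≟V_ = SumP.≡-dec _≟₁_ (decSub _≟₂_ P₂)
    }

infixl 5 _⊹_
_⊹_ : TGraph → TGraph → TGraph
G₁ ⊹ G₂ = Serial.graph G₁ G₂

infixl 5 _∥_
_∥_ : TGraph → TGraph → TGraph
G₁ ∥ G₂ = Parallel.graph G₁ G₂

record _≅_ (G H : TGraph) : Set where
  field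
    fV : V G ↔ V H
    fE : E G ↔ E H
    ends-pres : ∀ e →
      (ends H (Inverse.to fE e) ≡ (Inverse.to fV (proj₁ (ends G e)) , Inverse.to fV (proj₂ (ends G e))))
      ⊎ (ends H (Inverse.to fE e) ≡ (Inverse.to fV (proj₂ (ends G e)) , Inverse.to fV (proj₁ (ends G e))))
    s-pres : Inverse.to fV (s G) ≡ s H
    t-pres : Inverse.to fV (t G) ≡ t H

data SPTerm : Set where
  edge : SPTerm
  ser  : SPTerm → SPTerm → SPTerm
  par  : SPTerm → SPTerm → SPTerm

⟦_⟧ : SPTerm → TGraph
⟦ edge ⟧ = K2
⟦ ser a b ⟧ = ⟦ a ⟧ ⊹ ⟦ b ⟧
⟦ par a b ⟧ = ⟦ a ⟧ ∥ ⟦ b ⟧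

SeriesParallel : TGraph → Set
SeriesParallel G = Σ SPTerm λ τ → ⟦ τ ⟧ ≅ G

record Subgraph (G : TGraph) : Set where
  field
    inV : V G → Bool
    inE : E G → Bool
    s∈  : T (inV (s G))
    t∈  : T (inV (t G))
    closed : ∀ e → T (inE e) → T (inV (proj₁ (ends G e))) × T (inV (proj₂ (ends G e)))

  Proper : Set
  Proper = (∃ λ v → inV v ≡ false) ⊎ (∃ λ e → inE e ≡ false)

  graph : TGraph
  graph = record
    { V = Σ (V G) (T ∘ inV)
    ; E = Σ (E G) (T ∘ inE)
    ; ends = λ { (e , p) → ((proj₁ (ends G e) , proj₁ (closed e p)) , (proj₂ (ends G e) , proj₂ (closed e p))) }
    ; s = (s G , s∈)
    ; t = (t G , t∈)
    ; s≢t = λ eq → s≢t G (cong proj₁ eq)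
    ; _≟V_ = decSub (_≟V_ G) inV
    }

deleteEdge : (G : TGraph) → E G → TGraph
deleteEdge G e = record
  { V = V G ; E = Σ (E G) (λ e' → e' ≢ e) ; ends = λ p → ends G (proj₁ p)
  ; s = s G ; t = t G ; s≢t = s≢t G ; _≟V_ = _≟V_ G }

module _ (k : ℕ) where

  open ZOps k

  Colouring : TGraph → Set
  Colouring G = Σ (V G → Z k) λ φ → ∀ e → Adj (φ (proj₁ (ends G e))) (φ (proj₂ (ends G e)))

  Realises : TGraph → Z k → Set
  Realises G x = Σ (Colouring G) λ c → (proj₁ c (s G) ≡ zeroZ) × (proj₁ c (t G) ≡ x)

  Forcing : TGraph → Subset (suc (k + k)) → Set
  Forcing G S = Nonempty S × (∀ x → (x ∈ S → Realises G x) × (Realises G x → x ∈ S))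

  MinForcing : TGraph → Subset (suc (k + k)) → Set
  MinForcing G S = Forcing G S × (∀ (H : Subgraph G) → Subgraph.Proper H → ¬ Forcing (Subgraph.graph H) S)

  𝓕 : Subset (suc (k + k)) → Subset (suc (k + k)) → TGraph → Set
  𝓕 S T G = SeriesParallel G × MinForcing G S
            × (∀ (e : E G) → ∃ λ x → x ∈ T × Realises (deleteEdge G e) x)

  Family : Set₁
  Family = Subset (suc (k + k)) → Subset (suc (k + k)) → TGraph → Set

  IsoInvariant : Family → Set₁
  IsoInvariant Φ = ∀ R Q G H → G ≅ H → Φ R Q G → Φ R Q H

  Closed : Family → Set₁
  Closed Φ =
      (∀ X → Nonempty X → Symmetric X → X ⊆ s̄1 → Φ s1 X K2)
    × (∀ Q R → Disjoint Q R → Nonempty Q → Nonempty R → Symmetric Q → Symmetric R →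
       ∀ S T → Symmetric S → Symmetric T → R ≡ S ∩ T →
       Nonempty (Q ∩ (T ─ S)) → Nonempty (Q ∩ (S ─ T)) →
       ∀ G₁ G₂ → Φ S (Q ∩ (T ─ S)) G₁ → Φ T (Q ∩ (S ─ T)) G₂ → Φ R Q (G₁ ∥ G₂))
    × (∀ Q R → Disjoint Q R → Nonempty Q → Nonempty R → Symmetric Q → Symmetric R →
       ∀ S T → Symmetric S → Symmetric T → R ≡ S ⊞ T →
       Nonempty (Q ⟨ T ⟩) → Nonempty (Q ⟨ S ⟩) →
       ∀ G₁ G₂ → Φ S (Q ⟨ T ⟩) G₁ → Φ T (Q ⟨ S ⟩) G₂ → Φ R Q (G₁ ⊹ G₂))

  Contains𝓕 : Family → Set₁
  Contains𝓕 Φ = ∀ R Q → Disjoint Q R → Nonempty Q → Nonempty R → Symmetric Q → Symmetric R →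
                ∀ G → 𝓕 R Q G → Φ R Q G

-- Every series-parallel term τ has a forced set: K₂ forces s(1), and G₁ ∥ G₂ and G₁ + G₂
-- force S ∩ T and S + T, since colourings of the summands can be glued after translating the
-- one of G₂ (colourings of C_{2k+1} are invariant under translation and negation; the latter
-- makes forced sets symmetric). Deleting an edge of one summand splits in the same way, which
-- moves the condition "every G − e realises a value of Q" between G and its summands, with the
-- targets Q ∩ (T ∖ S), Q ∩ (S ∖ T), Q_T and Q_S of the two constructions. Minimality comes for
-- free: a proper subgraph of a graph without isolated vertices misses an edge e, so it realises
-- everything G − e does, including a value of Q outside R. Hence 𝓕 is closed under the
-- constructions, and conversely, recursion on the term decomposes any member of 𝓕_R^Q along the
-- same rules, so every isomorphism-invariant closed family contains it.

module Submission where

open import Level using (0ℓ)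
open import Algebra.Bundles using (AbelianGroup)
open import Algebra.Structures using (IsAbelianGroup)
import Algebra.Properties.AbelianGroup as AbelianGroupProperties
import Algebra.Properties.CommutativeSemigroup as CommutativeSemigroupProperties
open import Data.Bool using (Bool; T; not; true; false)
open import Data.Bool.Properties using (T-≡; T-irrelevant; T-∧)
open import Data.Empty using (⊥-elim)
open import Data.Fin using (Fin; toℕ)
import Data.Fin as Fin
open import Data.Fin.Properties using (toℕ-injective; toℕ-fromℕ<; toℕ<n; any?)
open import Data.Fin.Subset using (Subset; _∈_; _∉_; _∩_; _─_; _⊆_; ⁅_⁆; Nonempty; inside; outside)
open import Data.Fin.Subset.Properties
  using ( _∈?_; ⊆-antisym; x∈⁅x⁆; x∈⁅y⁆⇒x≡y; x∈p∪q⁺; x∈p∪q⁻; x∈p∩q⁺; x∈p∩q⁻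
        ; x∈∁p⇒x∉p; x∉p⇒x∈∁p; p─q⊆p; x∈p∧x∉q⇒x∈p─q)
open import Data.Nat using (ℕ; suc; _+_; _∸_; _%_; _≤_)
open import Data.Nat.DivMod using (_mod_; %-distribˡ-+; m<n⇒m%n≡m; n%n≡0; m%n%n≡m%n; m%n<n)
open import Data.Nat.Properties using (+-comm; +-assoc; m∸n+n≡m; <⇒≤)
open import Data.Product using (Σ; ∃; ∃₂; _×_; _,_; proj₁; proj₂)
import Data.Product as Product
open import Data.Sum using (_⊎_; inj₁; inj₂)
import Data.Sum as Sum
open import Data.Sum.Properties using (inj₁-injective; inj₂-injective)
open import Data.Unit using (⊤; tt)
open import Data.Vec using (_∷_; here; there; tabulate)
open import Data.Vec.Properties using (lookup∘tabulate; []=⇒lookup; lookup⇒[]=)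
open import Function using (_∘_)
open import Function.Bundles using (Inverse; Injection; Equivalence; mk↔ₛ′)
open import Function.Properties.Inverse using (↔-refl; ↔-sym; Inverse⇒Injection)
open import Relation.Nullary using (Dec; yes; no; does; ¬_)
open import Relation.Nullary.Decidable using (⌊_⌋; _×-dec_; toWitness; fromWitness)
open import Relation.Binary.PropositionalEquality

open import Defs

-- Arithmetic of ℤ_{2k+1}

module ℤₘ (k : ℕ) where
  open ZOps k

  toℕ-mod : ∀ n → toℕ (n mod m) ≡ n % m
  toℕ-mod n = toℕ-fromℕ< (m%n<n n m)

  %-absorbˡ : ∀ x y → (x % m + y) % m ≡ (x + y) % m
  %-absorbˡ x y = begin
    (x % m + y) % m           ≡⟨ %-distribˡ-+ (x % m) y m ⟩
    (x % m % m + y % m) % m   ≡⟨ cong (λ n → (n + y % m) % m) (m%n%n≡m%n x m) ⟩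
    (x % m + y % m) % m       ≡⟨ %-distribˡ-+ x y m ⟨
    (x + y) % m               ∎
    where open ≡-Reasoning

  %-absorbʳ : ∀ x y → (x + y % m) % m ≡ (x + y) % m
  %-absorbʳ x y = begin
    (x + y % m) % m  ≡⟨ cong (_% m) (+-comm x (y % m)) ⟩
    (y % m + x) % m  ≡⟨ %-absorbˡ y x ⟩
    (y + x) % m      ≡⟨ cong (_% m) (+-comm y x) ⟩
    (x + y) % m      ∎
    where open ≡-Reasoning

  toℕ-⊕ : ∀ a b → toℕ (a ⊕ b) ≡ (toℕ a + toℕ b) % m
  toℕ-⊕ a b = toℕ-mod (toℕ a + toℕ b)

  ⊕-comm : ∀ a b → a ⊕ b ≡ b ⊕ a
  ⊕-comm a b = cong (_mod m) (+-comm (toℕ a) (toℕ b))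

  ⊕-assoc : ∀ a b c → (a ⊕ b) ⊕ c ≡ a ⊕ (b ⊕ c)
  ⊕-assoc a b c = toℕ-injective (begin
    toℕ ((a ⊕ b) ⊕ c)                    ≡⟨ toℕ-⊕ (a ⊕ b) c ⟩
    (toℕ (a ⊕ b) + toℕ c) % m            ≡⟨ cong (λ n → (n + toℕ c) % m) (toℕ-⊕ a b) ⟩
    ((toℕ a + toℕ b) % m + toℕ c) % m    ≡⟨ %-absorbˡ (toℕ a + toℕ b) (toℕ c) ⟩
    (toℕ a + toℕ b + toℕ c) % m          ≡⟨ cong (_% m) (+-assoc (toℕ a) (toℕ b) (toℕ c)) ⟩
    (toℕ a + (toℕ b + toℕ c)) % m        ≡⟨ %-absorbʳ (toℕ a) (toℕ b + toℕ c) ⟨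
    (toℕ a + (toℕ b + toℕ c) % m) % m    ≡⟨ cong (λ n → (toℕ a + n) % m) (toℕ-⊕ b c) ⟨
    (toℕ a + toℕ (b ⊕ c)) % m            ≡⟨ toℕ-⊕ a (b ⊕ c) ⟨
    toℕ (a ⊕ (b ⊕ c))                    ∎)
    where open ≡-Reasoning

  ⊕-identityˡ : ∀ a → zeroZ ⊕ a ≡ a
  ⊕-identityˡ a = toℕ-injective (trans (toℕ-mod (toℕ a)) (m<n⇒m%n≡m (toℕ<n a)))

  ⊕-identityʳ : ∀ a → a ⊕ zeroZ ≡ a
  ⊕-identityʳ a = trans (⊕-comm a zeroZ) (⊕-identityˡ a)

  ⊕-inverseˡ : ∀ a → negZ a ⊕ a ≡ zeroZ
  ⊕-inverseˡ a = toℕ-injective (begin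
    toℕ (negZ a ⊕ a)                  ≡⟨ toℕ-⊕ (negZ a) a ⟩
    (toℕ (negZ a) + toℕ a) % m        ≡⟨ cong (λ n → (n + toℕ a) % m) (toℕ-mod (m ∸ toℕ a)) ⟩
    ((m ∸ toℕ a) % m + toℕ a) % m     ≡⟨ %-absorbˡ (m ∸ toℕ a) (toℕ a) ⟩
    (m ∸ toℕ a + toℕ a) % m           ≡⟨ cong (_% m) (m∸n+n≡m (<⇒≤ (toℕ<n a))) ⟩
    m % m                             ≡⟨ n%n≡0 m ⟩
    0                                 ∎)
    where open ≡-Reasoning

  ⊕-inverseʳ : ∀ a → a ⊕ negZ a ≡ zeroZ
  ⊕-inverseʳ a = trans (⊕-comm a (negZ a)) (⊕-inverseˡ a)

  ⊕-isAbelianGroup : IsAbelianGroup _≡_ _⊕_ zeroZ negZ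
  ⊕-isAbelianGroup = record
    { isGroup = record
      { isMonoid = record
        { isSemigroup = record
          { isMagma = record { isEquivalence = isEquivalence ; ∙-cong = cong₂ _⊕_ }
          ; assoc = ⊕-assoc }
        ; identity = ⊕-identityˡ , ⊕-identityʳ }
      ; inverse = ⊕-inverseˡ , ⊕-inverseʳ
      ; ⁻¹-cong = cong negZ }
    ; comm = ⊕-comm }

  ⊕-abelianGroup : AbelianGroup 0ℓ 0ℓ
  ⊕-abelianGroup = record { isAbelianGroup = ⊕-isAbelianGroup }

  open AbelianGroupProperties ⊕-abelianGroup public
  open CommutativeSemigroupProperties (AbelianGroup.commutativeSemigroup ⊕-abelianGroup) public
    using (xy∙z≈xz∙y)

  Adj-sym : ∀ {a b} → Adj a b → Adj b a
  Adj-sym (inj₁ a≡b+1) = inj₂ a≡b+1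
  Adj-sym (inj₂ b≡a+1) = inj₁ b≡a+1

  Adj-⊕ʳ : ∀ {a b} c → Adj a b → Adj (a ⊕ c) (b ⊕ c)
  Adj-⊕ʳ {b = b} c (inj₁ refl) = inj₁ (xy∙z≈xz∙y b oneZ c)
  Adj-⊕ʳ {a = a} c (inj₂ refl) = inj₂ (xy∙z≈xz∙y a oneZ c)

  negZ-successor : ∀ b → negZ b ≡ negZ (b ⊕ oneZ) ⊕ oneZ
  negZ-successor b = sym (begin
    negZ (b ⊕ oneZ) ⊕ oneZ         ≡⟨ cong (_⊕ oneZ) (⁻¹-∙-comm b oneZ) ⟨
    (negZ b ⊕ negZ oneZ) ⊕ oneZ    ≡⟨ ⊕-assoc (negZ b) (negZ oneZ) oneZ ⟩
    negZ b ⊕ (negZ oneZ ⊕ oneZ)    ≡⟨ cong (negZ b ⊕_) (⊕-inverseˡ oneZ) ⟩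
    negZ b ⊕ zeroZ                 ≡⟨ ⊕-identityʳ (negZ b) ⟩
    negZ b                         ∎)
    where open ≡-Reasoning

  Adj-negZ : ∀ {a b} → Adj a b → Adj (negZ a) (negZ b)
  Adj-negZ {b = b} (inj₁ refl) = inj₂ (negZ-successor b)
  Adj-negZ {a = a} (inj₂ refl) = inj₁ (negZ-successor a)

  Adj-zero⇒∈s1 : ∀ {x} → Adj zeroZ x → x ∈ s1
  Adj-zero⇒∈s1 {x} (inj₁ 0≡x+1) =
    x∈p∪q⁺ (inj₂ (subst (_∈ ⁅ negZ oneZ ⁆) (sym (inverseˡ-unique x oneZ (sym 0≡x+1))) (x∈⁅x⁆ _)))
  Adj-zero⇒∈s1 {x} (inj₂ x≡0+1) =
    x∈p∪q⁺ (inj₁ (subst (_∈ ⁅ oneZ ⁆) (sym (trans x≡0+1 (⊕-identityˡ oneZ))) (x∈⁅x⁆ _)))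

  ∈s1⇒Adj-zero : ∀ {x} → x ∈ s1 → Adj zeroZ x
  ∈s1⇒Adj-zero x∈s1 with x∈p∪q⁻ ⁅ oneZ ⁆ ⁅ negZ oneZ ⁆ x∈s1
  ... | inj₁ x∈⁅1⁆  = inj₂ (trans (x∈⁅y⁆⇒x≡y _ x∈⁅1⁆) (sym (⊕-identityˡ oneZ)))
  ... | inj₂ x∈⁅-1⁆ = inj₁ (sym (trans (cong (_⊕ oneZ) (x∈⁅y⁆⇒x≡y _ x∈⁅-1⁆)) (⊕-inverseˡ oneZ)))

x∈p─q⇒x∉q : ∀ {n} (p q : Subset n) {x} → x ∈ p ─ q → x ∉ q
x∈p─q⇒x∉q (inside ∷ p) (outside ∷ q) here ()
x∈p─q⇒x∉q (_ ∷ p) (_ ∷ q) (there x∈p─q) (there x∈q) = x∈p─q⇒x∉q p q x∈p─q x∈q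

∈-tabulate⁻ : ∀ {n} (f : Fin n → Bool) {x} → x ∈ tabulate f → T (f x)
∈-tabulate⁻ f {x} x∈ = Equivalence.from T-≡ (trans (sym (lookup∘tabulate f x)) ([]=⇒lookup x∈))

∈-tabulate⁺ : ∀ {n} (f : Fin n → Bool) {x} → T (f x) → x ∈ tabulate f
∈-tabulate⁺ f {x} fx = lookup⇒[]= x (tabulate f) (trans (lookup∘tabulate f x) (Equivalence.to T-≡ fx))

module SubsetSums (k : ℕ) where
  open ZOps k
  open ℤₘ k

  sum? : ∀ S T z → Dec (∃₂ λ x y → x ∈ S × y ∈ T × z ≡ x ⊕ y)
  sum? S T z = any? λ x → any? λ y → (x ∈? S) ×-dec ((y ∈? T) ×-dec (z Fin.≟ x ⊕ y))

  hits? : ∀ Q S x → Dec (∃ λ y → y ∈ S × x ⊕ y ∈ Q)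
  hits? Q S x = any? λ y → (y ∈? S) ×-dec ((x ⊕ y) ∈? Q)

  ∈-⊞⁻ : ∀ {S T z} → z ∈ S ⊞ T → ∃₂ λ x y → x ∈ S × y ∈ T × z ≡ x ⊕ y
  ∈-⊞⁻ {S} {T} {z} z∈ = toWitness {a? = sum? S T z} (∈-tabulate⁻ (λ z → ⌊ sum? S T z ⌋) z∈)

  ∈-⊞⁺ : ∀ {S T x y} → x ∈ S → y ∈ T → x ⊕ y ∈ S ⊞ T
  ∈-⊞⁺ {S} {T} {x} {y} x∈S y∈T =
    ∈-tabulate⁺ (λ z → ⌊ sum? S T z ⌋) (fromWitness {a? = sum? S T (x ⊕ y)} (x , y , x∈S , y∈T , refl))

  ∈-⟨⟩⁻ : ∀ {Q S x} → x ∈ Q ⟨ S ⟩ → ∃ λ y → y ∈ S × x ⊕ y ∈ Q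
  ∈-⟨⟩⁻ {Q} {S} {x} x∈ = toWitness {a? = hits? Q S x} (∈-tabulate⁻ (λ x → ⌊ hits? Q S x ⌋) x∈)

  ∈-⟨⟩⁺ : ∀ {Q S x y} → y ∈ S → x ⊕ y ∈ Q → x ∈ Q ⟨ S ⟩
  ∈-⟨⟩⁺ {Q} {S} {x} {y} y∈S x+y∈Q =
    ∈-tabulate⁺ (λ x → ⌊ hits? Q S x ⌋) (fromWitness {a? = hits? Q S x} (y , y∈S , x+y∈Q))

  Symmetric-∩─ : ∀ {Q S T} → Symmetric Q → Symmetric S → Symmetric T → Symmetric (Q ∩ (T ─ S))
  Symmetric-∩─ {Q} {S} {T} symQ symS symT x x∈ =
    x∈p∩q⁺ (symQ x x∈Q , x∈p∧x∉q⇒x∈p─q (symT x (p─q⊆p T S x∈T─S)) -x∉S)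
    where
    x∈Q = proj₁ (x∈p∩q⁻ Q (T ─ S) x∈)
    x∈T─S = proj₂ (x∈p∩q⁻ Q (T ─ S) x∈)
    -x∉S : negZ x ∉ S
    -x∉S -x∈S = x∈p─q⇒x∉q T S x∈T─S (subst (_∈ S) (⁻¹-involutive x) (symS (negZ x) -x∈S))

  Symmetric-⟨⟩ : ∀ {Q T} → Symmetric Q → Symmetric T → Symmetric (Q ⟨ T ⟩)
  Symmetric-⟨⟩ {Q} {T} symQ symT x x∈ =
    let (y , y∈T , x+y∈Q) = ∈-⟨⟩⁻ {Q} {T} x∈ in
    ∈-⟨⟩⁺ {Q} {T} (symT y y∈T) (subst (_∈ Q) (sym (⁻¹-∙-comm x y)) (symQ _ x+y∈Q))

  Disjoint-∩─ : ∀ Q S T → Disjoint (Q ∩ (T ─ S)) S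
  Disjoint-∩─ Q S T x x∈ = x∈p─q⇒x∉q T S (proj₂ (x∈p∩q⁻ Q (T ─ S) x∈))

  Disjoint-⟨⟩ˡ : ∀ {Q S T} → Disjoint Q (S ⊞ T) → Disjoint (Q ⟨ T ⟩) S
  Disjoint-⟨⟩ˡ {Q} {S} {T} Q∩R=∅ x x∈ x∈S =
    let (y , y∈T , x+y∈Q) = ∈-⟨⟩⁻ {Q} {T} x∈ in Q∩R=∅ (x ⊕ y) x+y∈Q (∈-⊞⁺ x∈S y∈T)

  Disjoint-⟨⟩ʳ : ∀ {Q S T} → Disjoint Q (S ⊞ T) → Disjoint (Q ⟨ S ⟩) T
  Disjoint-⟨⟩ʳ {Q} {S} {T} Q∩R=∅ y y∈ y∈T =
    let (x , x∈S , y+x∈Q) = ∈-⟨⟩⁻ {Q} {S} y∈ in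
    Q∩R=∅ (x ⊕ y) (subst (_∈ Q) (⊕-comm y x) y+x∈Q) (∈-⊞⁺ x∈S y∈T)

-- Parallel and serial sums

Touches : (G : TGraph) → E G → V G → Set
Touches G e v = (proj₁ (ends G e) ≡ v) ⊎ (proj₂ (ends G e) ≡ v)

NoIsolatedVertex : TGraph → Set
NoIsolatedVertex G = ∀ v → ∃ λ e → Touches G e v

T-not-does⇒¬ : ∀ {A : Set} (a? : Dec A) → T (not (does a?)) → ¬ A
T-not-does⇒¬ (no ¬a) _ = ¬a

module ParallelSum (G₁ G₂ : TGraph) where
  open Parallel G₁ G₂ public using (P₂; emb)

  Inner : Set
  Inner = Σ (V G₂) (T ∘ P₂)

  inner-≡ : ∀ {u v} → u ≡ v → (p : T (P₂ u)) (q : T (P₂ v)) → (u , p) ≡ (v , q)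
  inner-≡ refl p q = cong (_ ,_) (T-irrelevant p q)

  inner≢s : (q : Inner) → proj₁ q ≢ s G₂
  inner≢s (v , p) = T-not-does⇒¬ (_≟V_ G₂ v (s G₂)) (proj₁ (Equivalence.to T-∧ p))

  inner≢t : (q : Inner) → proj₁ q ≢ t G₂
  inner≢t (v , p) = T-not-does⇒¬ (_≟V_ G₂ v (t G₂)) (proj₂ (Equivalence.to T-∧ p))

  -- Indexed by `emb v`, so that matching on `embView v` also rewrites `emb v`.
  data EmbView (v : V G₂) : Parallel.W G₁ G₂ → Set where
    at-s  : v ≡ s G₂ → EmbView v (inj₁ (s G₁))
    at-t  : v ≡ t G₂ → EmbView v (inj₁ (t G₁))
    inner : (q : Inner) → proj₁ q ≡ v → EmbView v (inj₂ q)

  embView : ∀ v → EmbView v (emb v)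
  embView v with _≟V_ G₂ v (s G₂)
  ... | yes v≡s = at-s v≡s
  ... | no _ with _≟V_ G₂ v (t G₂)
  ...   | yes v≡t = at-t v≡t
  ...   | no _ = inner _ refl

  emb-s : emb (s G₂) ≡ inj₁ (s G₁)
  emb-s with emb (s G₂) | embView (s G₂)
  ... | _ | at-s _      = refl
  ... | _ | at-t s≡t    = ⊥-elim (s≢t G₂ s≡t)
  ... | _ | inner q q≡s = ⊥-elim (inner≢s q q≡s)

  emb-t : emb (t G₂) ≡ inj₁ (t G₁)
  emb-t with emb (t G₂) | embView (t G₂)
  ... | _ | at-s t≡s    = ⊥-elim (s≢t G₂ (sym t≡s))
  ... | _ | at-t _      = refl
  ... | _ | inner q q≡t = ⊥-elim (inner≢t q q≡t)

  emb-inner : (q : Inner) → emb (proj₁ q) ≡ inj₂ q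
  emb-inner q with emb (proj₁ q) | embView (proj₁ q)
  ... | _ | at-s q≡s     = ⊥-elim (inner≢s q q≡s)
  ... | _ | at-t q≡t     = ⊥-elim (inner≢t q q≡t)
  ... | _ | inner q′ q≡q = cong inj₂ (inner-≡ q≡q (proj₂ q′) (proj₂ q))

  noIsolatedVertex : NoIsolatedVertex G₁ → NoIsolatedVertex G₂ → NoIsolatedVertex (G₁ ∥ G₂)
  noIsolatedVertex n₁ n₂ (inj₁ v) with n₁ v
  ... | e , touch = inj₁ e , Sum.map (cong inj₁) (cong inj₁) touch
  noIsolatedVertex n₁ n₂ (inj₂ q) with n₂ (proj₁ q)
  ... | e , touch = inj₂ e , Sum.map toInner toInner touch
    where
    toInner : ∀ {u} → u ≡ proj₁ q → emb u ≡ inj₂ q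
    toInner refl = emb-inner q

module SerialSum (G₁ G₂ : TGraph) where
  open Serial G₁ G₂ public using (P₂; emb)

  Inner : Set
  Inner = Σ (V G₂) (T ∘ P₂)

  inner-≡ : ∀ {u v} → u ≡ v → (p : T (P₂ u)) (q : T (P₂ v)) → (u , p) ≡ (v , q)
  inner-≡ refl p q = cong (_ ,_) (T-irrelevant p q)

  inner≢s : (q : Inner) → proj₁ q ≢ s G₂
  inner≢s (v , p) = T-not-does⇒¬ (_≟V_ G₂ v (s G₂)) p

  data EmbView (v : V G₂) : Serial.W G₁ G₂ → Set where
    at-s  : v ≡ s G₂ → EmbView v (inj₁ (t G₁))
    inner : (q : Inner) → proj₁ q ≡ v → EmbView v (inj₂ q)

  embView : ∀ v → EmbView v (emb v)
  embView v with _≟V_ G₂ v (s G₂)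
  ... | yes v≡s = at-s v≡s
  ... | no _ = inner _ refl

  emb-s : emb (s G₂) ≡ inj₁ (t G₁)
  emb-s with emb (s G₂) | embView (s G₂)
  ... | _ | at-s _      = refl
  ... | _ | inner q q≡s = ⊥-elim (inner≢s q q≡s)

  emb-inner : (q : Inner) → emb (proj₁ q) ≡ inj₂ q
  emb-inner q with emb (proj₁ q) | embView (proj₁ q)
  ... | _ | at-s q≡s     = ⊥-elim (inner≢s q q≡s)
  ... | _ | inner q′ q≡q = cong inj₂ (inner-≡ q≡q (proj₂ q′) (proj₂ q))

  emb-t : emb (t G₂) ≡ t (G₁ ⊹ G₂)
  emb-t = emb-inner (t G₂ , notDoes (_≟V_ G₂) (λ t≡s → s≢t G₂ (sym t≡s)))

  noIsolatedVertex : NoIsolatedVertex G₁ → NoIsolatedVertex G₂ → NoIsolatedVertex (G₁ ⊹ G₂)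
  noIsolatedVertex n₁ n₂ (inj₁ v) with n₁ v
  ... | e , touch = inj₁ e , Sum.map (cong inj₁) (cong inj₁) touch
  noIsolatedVertex n₁ n₂ (inj₂ q) with n₂ (proj₁ q)
  ... | e , touch = inj₂ e , Sum.map toInner toInner touch
    where
    toInner : ∀ {u} → u ≡ proj₁ q → emb u ≡ inj₂ q
    toInner refl = emb-inner q

-- Isomorphisms

-- The shape of `_≅_.ends-pres`: an isomorphism may reverse an edge.
EitherOrder : {A : Set} → A × A → A → A → Set
EitherOrder p a b = (p ≡ (a , b)) ⊎ (p ≡ (b , a))

eitherOrder-map : ∀ {A B : Set} (g : A → B) {p : A × A} {a b} →
                  EitherOrder p a b → EitherOrder (Product.map g g p) (g a) (g b)
eitherOrder-map g = Sum.map (cong (Product.map g g)) (cong (Product.map g g))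

eitherOrder-sym : ∀ {A : Set} {p : A × A} {a b} → EitherOrder p a b → EitherOrder (a , b) (proj₁ p) (proj₂ p)
eitherOrder-sym (inj₁ refl) = inj₁ refl
eitherOrder-sym (inj₂ refl) = inj₂ refl

eitherOrder-subst : ∀ {A : Set} {p : A × A} {a a′ b b′} → a ≡ a′ → b ≡ b′ →
                    EitherOrder p a b → EitherOrder p a′ b′
eitherOrder-subst refl refl o = o

eitherOrder-touches : ∀ {A : Set} {p : A × A} {a b w} → EitherOrder p a b →
                      (a ≡ w) ⊎ (b ≡ w) → (proj₁ p ≡ w) ⊎ (proj₂ p ≡ w)
eitherOrder-touches (inj₁ refl) touch = touch
eitherOrder-touches (inj₂ refl) touch = Sum.swap touch

module _ {G H : TGraph} (i : G ≅ H) where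
  open _≅_ i

  ≅-vertex : V G → V H
  ≅-vertex = Inverse.to fV

  ≅-edge : E G → E H
  ≅-edge = Inverse.to fE

  ≅-vertex-injective : ∀ {u v} → ≅-vertex u ≡ ≅-vertex v → u ≡ v
  ≅-vertex-injective = Injection.injective (Inverse⇒Injection fV)

  ≅-edge-injective : ∀ {e e′} → ≅-edge e ≡ ≅-edge e′ → e ≡ e′
  ≅-edge-injective = Injection.injective (Inverse⇒Injection fE)

≅-refl : ∀ {G} → G ≅ G
≅-refl = record
  { fV = ↔-refl ; fE = ↔-refl ; ends-pres = λ _ → inj₁ refl ; s-pres = refl ; t-pres = refl }

≅-sym : ∀ {G H} → G ≅ H → H ≅ G
≅-sym {G} {H} i = record
  { fV = ↔-sym fV
  ; fE = ↔-sym fE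
  ; ends-pres = ends-pres⁻¹
  ; s-pres = from-≡ s-pres
  ; t-pres = from-≡ t-pres
  }
  where
  open _≅_ i
  open Inverse fV using (to; from; strictlyInverseʳ)

  from-≡ : ∀ {v w} → to v ≡ w → from w ≡ v
  from-≡ refl = strictlyInverseʳ _

  ends-pres⁻¹ : ∀ e → EitherOrder (ends G (Inverse.from fE e)) (from (proj₁ (ends H e))) (from (proj₂ (ends H e)))
  ends-pres⁻¹ e = eitherOrder-sym (eitherOrder-subst (strictlyInverseʳ _) (strictlyInverseʳ _)
    (eitherOrder-map from (subst (λ e′ → EitherOrder (ends H e′) _ _) (Inverse.strictlyInverseˡ fE e)
      (ends-pres (Inverse.from fE e)))))

module ∥-CongruenceMaps {A₁ A₂ G₁ G₂ : TGraph} (i₁ : A₁ ≅ G₁) (i₂ : A₂ ≅ G₂) where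
  private
    module A = ParallelSum A₁ A₂
    module G = ParallelSum G₁ G₂

  innerMap : A.Inner → G.Inner
  innerMap q = ≅-vertex i₂ (proj₁ q) , Equivalence.from T-∧
    ( notDoes (_≟V_ G₂) (λ fq≡s → A.inner≢s q (≅-vertex-injective i₂ (trans fq≡s (sym (_≅_.s-pres i₂)))))
    , notDoes (_≟V_ G₂) (λ fq≡t → A.inner≢t q (≅-vertex-injective i₂ (trans fq≡t (sym (_≅_.t-pres i₂))))))

  vertexMap : V (A₁ ∥ A₂) → V (G₁ ∥ G₂)
  vertexMap = Sum.map (≅-vertex i₁) innerMap

  edgeMap : E (A₁ ∥ A₂) → E (G₁ ∥ G₂)
  edgeMap = Sum.map (≅-edge i₁) (≅-edge i₂)

  emb-natural : ∀ v → G.emb (≅-vertex i₂ v) ≡ vertexMap (A.emb v)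
  emb-natural v with A.emb v | A.embView v
  ... | _ | A.at-s refl = trans (cong G.emb (_≅_.s-pres i₂)) (trans G.emb-s (cong inj₁ (sym (_≅_.s-pres i₁))))
  ... | _ | A.at-t refl = trans (cong G.emb (_≅_.t-pres i₂)) (trans G.emb-t (cong inj₁ (sym (_≅_.t-pres i₁))))
  ... | _ | A.inner q refl = G.emb-inner (innerMap q)

  ends-natural : ∀ e → EitherOrder (ends (G₁ ∥ G₂) (edgeMap e))
                                   (vertexMap (proj₁ (ends (A₁ ∥ A₂) e))) (vertexMap (proj₂ (ends (A₁ ∥ A₂) e)))
  ends-natural (inj₁ e) = eitherOrder-map inj₁ (_≅_.ends-pres i₁ e)
  ends-natural (inj₂ e) = eitherOrder-subst (emb-natural _) (emb-natural _)
                            (eitherOrder-map G.emb (_≅_.ends-pres i₂ e))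

∥-cong : ∀ {A₁ A₂ G₁ G₂} → A₁ ≅ G₁ → A₂ ≅ G₂ → (A₁ ∥ A₂) ≅ (G₁ ∥ G₂)
∥-cong {A₁} {A₂} {G₁} {G₂} i₁ i₂ = record
  { fV = mk↔ₛ′ To.vertexMap From.vertexMap
      (Sum.[ cong inj₁ ∘ V₁.strictlyInverseˡ , (λ q → cong inj₂ (G.inner-≡ (V₂.strictlyInverseˡ (proj₁ q)) _ _)) ])
      (Sum.[ cong inj₁ ∘ V₁.strictlyInverseʳ , (λ q → cong inj₂ (A.inner-≡ (V₂.strictlyInverseʳ (proj₁ q)) _ _)) ])
  ; fE = mk↔ₛ′ To.edgeMap From.edgeMap
      (Sum.[ cong inj₁ ∘ E₁.strictlyInverseˡ , cong inj₂ ∘ E₂.strictlyInverseˡ ])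
      (Sum.[ cong inj₁ ∘ E₁.strictlyInverseʳ , cong inj₂ ∘ E₂.strictlyInverseʳ ])
  ; ends-pres = To.ends-natural
  ; s-pres = cong inj₁ (_≅_.s-pres i₁)
  ; t-pres = cong inj₁ (_≅_.t-pres i₁)
  }
  where
  module To = ∥-CongruenceMaps i₁ i₂
  module From = ∥-CongruenceMaps (≅-sym i₁) (≅-sym i₂)
  module A = ParallelSum A₁ A₂
  module G = ParallelSum G₁ G₂
  module V₁ = Inverse (_≅_.fV i₁)
  module V₂ = Inverse (_≅_.fV i₂)
  module E₁ = Inverse (_≅_.fE i₁)
  module E₂ = Inverse (_≅_.fE i₂)

module ⊹-CongruenceMaps {A₁ A₂ G₁ G₂ : TGraph} (i₁ : A₁ ≅ G₁) (i₂ : A₂ ≅ G₂) where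
  private
    module A = SerialSum A₁ A₂
    module G = SerialSum G₁ G₂

  innerMap : A.Inner → G.Inner
  innerMap q = ≅-vertex i₂ (proj₁ q) ,
    notDoes (_≟V_ G₂) (λ fq≡s → A.inner≢s q (≅-vertex-injective i₂ (trans fq≡s (sym (_≅_.s-pres i₂)))))

  vertexMap : V (A₁ ⊹ A₂) → V (G₁ ⊹ G₂)
  vertexMap = Sum.map (≅-vertex i₁) innerMap

  edgeMap : E (A₁ ⊹ A₂) → E (G₁ ⊹ G₂)
  edgeMap = Sum.map (≅-edge i₁) (≅-edge i₂)

  emb-natural : ∀ v → G.emb (≅-vertex i₂ v) ≡ vertexMap (A.emb v)
  emb-natural v with A.emb v | A.embView v
  ... | _ | A.at-s refl = trans (cong G.emb (_≅_.s-pres i₂)) (trans G.emb-s (cong inj₁ (sym (_≅_.t-pres i₁))))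
  ... | _ | A.inner q refl = G.emb-inner (innerMap q)

  ends-natural : ∀ e → EitherOrder (ends (G₁ ⊹ G₂) (edgeMap e))
                                   (vertexMap (proj₁ (ends (A₁ ⊹ A₂) e))) (vertexMap (proj₂ (ends (A₁ ⊹ A₂) e)))
  ends-natural (inj₁ e) = eitherOrder-map inj₁ (_≅_.ends-pres i₁ e)
  ends-natural (inj₂ e) = eitherOrder-subst (emb-natural _) (emb-natural _)
                            (eitherOrder-map G.emb (_≅_.ends-pres i₂ e))

⊹-cong : ∀ {A₁ A₂ G₁ G₂} → A₁ ≅ G₁ → A₂ ≅ G₂ → (A₁ ⊹ A₂) ≅ (G₁ ⊹ G₂)
⊹-cong {A₁} {A₂} {G₁} {G₂} i₁ i₂ = record
  { fV = mk↔ₛ′ To.vertexMap From.vertexMap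
      (Sum.[ cong inj₁ ∘ V₁.strictlyInverseˡ , (λ q → cong inj₂ (G.inner-≡ (V₂.strictlyInverseˡ (proj₁ q)) _ _)) ])
      (Sum.[ cong inj₁ ∘ V₁.strictlyInverseʳ , (λ q → cong inj₂ (A.inner-≡ (V₂.strictlyInverseʳ (proj₁ q)) _ _)) ])
  ; fE = mk↔ₛ′ To.edgeMap From.edgeMap
      (Sum.[ cong inj₁ ∘ E₁.strictlyInverseˡ , cong inj₂ ∘ E₂.strictlyInverseˡ ])
      (Sum.[ cong inj₁ ∘ E₁.strictlyInverseʳ , cong inj₂ ∘ E₂.strictlyInverseʳ ])
  ; ends-pres = To.ends-natural
  ; s-pres = cong inj₁ (_≅_.s-pres i₁)
  ; t-pres = cong inj₂ (G.inner-≡ (_≅_.t-pres i₂) _ _)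
  }
  where
  module To = ⊹-CongruenceMaps i₁ i₂
  module From = ⊹-CongruenceMaps (≅-sym i₁) (≅-sym i₂)
  module A = SerialSum A₁ A₂
  module G = SerialSum G₁ G₂
  module V₁ = Inverse (_≅_.fV i₁)
  module V₂ = Inverse (_≅_.fV i₂)
  module E₁ = Inverse (_≅_.fE i₁)
  module E₂ = Inverse (_≅_.fE i₂)

≅-noIsolatedVertex : ∀ {G H} → G ≅ H → NoIsolatedVertex G → NoIsolatedVertex H
≅-noIsolatedVertex {G} {H} i noIso w with noIso (Inverse.from (_≅_.fV i) w)
... | e , touch = ≅-edge i e , eitherOrder-touches (_≅_.ends-pres i e) (Sum.map toW toW touch)
  where
  toW : ∀ {v} → v ≡ Inverse.from (_≅_.fV i) w → ≅-vertex i v ≡ w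
  toW refl = Inverse.strictlyInverseˡ (_≅_.fV i) w

⟦⟧-noIsolatedVertex : ∀ τ → NoIsolatedVertex ⟦ τ ⟧
⟦⟧-noIsolatedVertex edge false = tt , inj₁ refl
⟦⟧-noIsolatedVertex edge true  = tt , inj₂ refl
⟦⟧-noIsolatedVertex (ser a b) =
  SerialSum.noIsolatedVertex ⟦ a ⟧ ⟦ b ⟧ (⟦⟧-noIsolatedVertex a) (⟦⟧-noIsolatedVertex b)
⟦⟧-noIsolatedVertex (par a b) =
  ParallelSum.noIsolatedVertex ⟦ a ⟧ ⟦ b ⟧ (⟦⟧-noIsolatedVertex a) (⟦⟧-noIsolatedVertex b)

proper⇒missingEdge : ∀ {G : TGraph} → NoIsolatedVertex G → (H : Subgraph G) → Subgraph.Proper H →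
                     ∃ λ e → Subgraph.inE H e ≡ false
proper⇒missingEdge noIso H (inj₂ missing) = missing
proper⇒missingEdge {G} noIso H (inj₁ (v , v∉H)) with noIso v
... | e , touch with Subgraph.inE H e in e∈?H
...   | false = e , e∈?H
...   | true = ⊥-elim (subst T v∉H (endpoint touch))
  where
  ends∈H : T (Subgraph.inV H (proj₁ (ends G e))) × T (Subgraph.inV H (proj₂ (ends G e)))
  ends∈H = Subgraph.closed H e (subst T (sym e∈?H) tt)
  endpoint : Touches G e v → T (Subgraph.inV H v)
  endpoint (inj₁ refl) = proj₁ ends∈H
  endpoint (inj₂ refl) = proj₂ ends∈H

seriesParallel-noIsolatedVertex : ∀ {G} → SeriesParallel G → NoIsolatedVertex G
seriesParallel-noIsolatedVertex (τ , i) = ≅-noIsolatedVertex i (⟦⟧-noIsolatedVertex τ)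

-- Colourings

module Colourings (k : ℕ) where
  open ZOps k
  open ℤₘ k
  open SubsetSums k

  -- Colourings required to respect only the edges satisfying P, so that G, G − e and the
  -- subgraphs of G are handled alike.
  RealisesOn : (G : TGraph) → (E G → Set) → Z k → Set
  RealisesOn G P x = Σ (V G → Z k) λ φ →
    (∀ e → P e → Adj (φ (proj₁ (ends G e))) (φ (proj₂ (ends G e)))) × (φ (s G) ≡ zeroZ) × (φ (t G) ≡ x)

  Everywhere : (G : TGraph) → E G → Set
  Everywhere G _ = ⊤

  Off : (G : TGraph) → E G → E G → Set
  Off G e e′ = e′ ≢ e

  realisesOn-weaken : ∀ {G P Q x} → (∀ e → Q e → P e) → RealisesOn G P x → RealisesOn G Q x
  realisesOn-weaken Q⇒P (φ , adj , φs , φt) = φ , (λ e q → adj e (Q⇒P e q)) , φs , φt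

  realises⇒everywhere : ∀ {G x} → Realises k G x → RealisesOn G (Everywhere G) x
  realises⇒everywhere ((φ , adj) , φs , φt) = φ , (λ e _ → adj e) , φs , φt

  everywhere⇒realises : ∀ {G x} → RealisesOn G (Everywhere G) x → Realises k G x
  everywhere⇒realises (φ , adj , φs , φt) = (φ , (λ e → adj e tt)) , φs , φt

  deleteEdge⇒off : ∀ {G e x} → Realises k (deleteEdge G e) x → RealisesOn G (Off G e) x
  deleteEdge⇒off ((φ , adj) , φs , φt) = φ , (λ e′ e′≢e → adj (e′ , e′≢e)) , φs , φt

  off⇒deleteEdge : ∀ {G e x} → RealisesOn G (Off G e) x → Realises k (deleteEdge G e) x
  off⇒deleteEdge (φ , adj , φs , φt) = (φ , (λ (e′ , e′≢e) → adj e′ e′≢e)) , φs , φt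

  realisesOn⇒subgraph : ∀ {G x} (H : Subgraph G) → RealisesOn G (T ∘ Subgraph.inE H) x → Realises k (Subgraph.graph H) x
  realisesOn⇒subgraph H (φ , adj , φs , φt) = (φ ∘ proj₁ , (λ (e , e∈H) → adj e e∈H)) , φs , φt

  module _ (G₁ G₂ : TGraph) where
    open ParallelSum G₁ G₂

    realisesOn-∥⁻ : ∀ {P x} → RealisesOn (G₁ ∥ G₂) P x →
                    RealisesOn G₁ (P ∘ inj₁) x × RealisesOn G₂ (P ∘ inj₂) x
    realisesOn-∥⁻ (φ , adj , φs , φt) =
        (φ ∘ inj₁ , adj ∘ inj₁ , φs , φt)
      , (φ ∘ emb , adj ∘ inj₂ , trans (cong φ emb-s) φs , trans (cong φ emb-t) φt)

    realisesOn-∥⁺ : ∀ {P x} → RealisesOn G₁ (P ∘ inj₁) x → RealisesOn G₂ (P ∘ inj₂) x →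
                    RealisesOn (G₁ ∥ G₂) P x
    realisesOn-∥⁺ {P} (φ₁ , adj₁ , φ₁s , φ₁t) (φ₂ , adj₂ , φ₂s , φ₂t) = φ , adj , φ₁s , φ₁t
      where
      φ : V (G₁ ∥ G₂) → Z k
      φ = Sum.[ φ₁ , φ₂ ∘ proj₁ ]

      φ∘emb : ∀ v → φ (emb v) ≡ φ₂ v
      φ∘emb v with emb v | embView v
      ... | _ | at-s refl     = trans φ₁s (sym φ₂s)
      ... | _ | at-t refl     = trans φ₁t (sym φ₂t)
      ... | _ | inner _ refl  = refl

      adj : ∀ e → P e → Adj (φ (proj₁ (ends (G₁ ∥ G₂) e))) (φ (proj₂ (ends (G₁ ∥ G₂) e)))
      adj (inj₁ e) = adj₁ e
      adj (inj₂ e) p = subst₂ Adj (sym (φ∘emb _)) (sym (φ∘emb _)) (adj₂ e p)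

  module _ (G₁ G₂ : TGraph) where
    open SerialSum G₁ G₂

    -- Shifting the colouring of G₂ by −x, x the colour of the middle vertex, makes it start at 0.
    realisesOn-⊹⁻ : ∀ {P z} → RealisesOn (G₁ ⊹ G₂) P z →
                    ∃₂ λ x y → RealisesOn G₁ (P ∘ inj₁) x × RealisesOn G₂ (P ∘ inj₂) y × z ≡ x ⊕ y
    realisesOn-⊹⁻ {z = z} (φ , adj , φs , φt) =
        x , z ⊕ negZ x
      , (φ ∘ inj₁ , adj ∘ inj₁ , φs , refl)
      , ((λ v → φ (emb v) ⊕ negZ x) , (λ e p → Adj-⊕ʳ (negZ x) (adj (inj₂ e) p))
        , trans (cong (λ w → φ w ⊕ negZ x) emb-s) (⊕-inverseʳ x)
        , cong (_⊕ negZ x) (trans (cong φ emb-t) φt))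
      , sym (trans (sym (⊕-assoc x z (negZ x))) (xyx⁻¹≈y x z))
      where
      x = φ (inj₁ (t G₁))

    realisesOn-⊹⁺ : ∀ {P x y} → RealisesOn G₁ (P ∘ inj₁) x → RealisesOn G₂ (P ∘ inj₂) y →
                    RealisesOn (G₁ ⊹ G₂) P (x ⊕ y)
    realisesOn-⊹⁺ {P} {x} {y} (φ₁ , adj₁ , φ₁s , φ₁t) (φ₂ , adj₂ , φ₂s , φ₂t) =
      φ , adj , φ₁s , trans (cong (_⊕ x) φ₂t) (⊕-comm y x)
      where
      φ : V (G₁ ⊹ G₂) → Z k
      φ = Sum.[ φ₁ , (λ (v , _) → φ₂ v ⊕ x) ]

      φ∘emb : ∀ v → φ (emb v) ≡ φ₂ v ⊕ x
      φ∘emb v with emb v | embView v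
      ... | _ | at-s refl     = trans φ₁t (sym (trans (cong (_⊕ x) φ₂s) (⊕-identityˡ x)))
      ... | _ | inner _ refl  = refl

      adj : ∀ e → P e → Adj (φ (proj₁ (ends (G₁ ⊹ G₂) e))) (φ (proj₂ (ends (G₁ ⊹ G₂) e)))
      adj (inj₁ e) = adj₁ e
      adj (inj₂ e) p = subst₂ Adj (sym (φ∘emb _)) (sym (φ∘emb _)) (Adj-⊕ʳ x (adj₂ e p))

  eitherOrder-Adj : ∀ {A : Set} (φ : A → Z k) {p : A × A} {a b} → EitherOrder p a b →
                    Adj (φ (proj₁ p)) (φ (proj₂ p)) → Adj (φ a) (φ b)
  eitherOrder-Adj φ (inj₁ refl) adj = adj
  eitherOrder-Adj φ (inj₂ refl) adj = Adj-sym adj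

  realisesOn-≅ : ∀ {G H} (i : G ≅ H) {P x} → RealisesOn H P x → RealisesOn G (P ∘ ≅-edge i) x
  realisesOn-≅ i (φ , adj , φs , φt) =
      φ ∘ ≅-vertex i
    , (λ e p → eitherOrder-Adj φ (_≅_.ends-pres i e) (adj (≅-edge i e) p))
    , trans (cong φ (_≅_.s-pres i)) φs
    , trans (cong φ (_≅_.t-pres i)) φt

  realises-≅ : ∀ {G H} → G ≅ H → ∀ {x} → Realises k H x → Realises k G x
  realises-≅ {G} {H} i = everywhere⇒realises {G} ∘ realisesOn-≅ i ∘ realises⇒everywhere {H}

  deleteEdge-≅ : ∀ {G H} (i : G ≅ H) {e x} → Realises k (deleteEdge H (≅-edge i e)) x → Realises k (deleteEdge G e) x
  deleteEdge-≅ {G} {H} i = off⇒deleteEdge {G} ∘ realisesOn-weaken {G} (λ _ e′≢e → e′≢e ∘ ≅-edge-injective i)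
                         ∘ realisesOn-≅ i ∘ deleteEdge⇒off {H}

  DeletionsReach : TGraph → Subset (suc (k + k)) → Set
  DeletionsReach G Q = ∀ e → ∃ λ x → x ∈ Q × Realises k (deleteEdge G e) x

  deletionsReach⇒minForcing : ∀ {G R Q} → NoIsolatedVertex G → Disjoint Q R →
                              Forcing k G R → DeletionsReach G Q → MinForcing k G R
  deletionsReach⇒minForcing {G} noIso Q∩R=∅ forcing reach = forcing , notForcing
    where
    notForcing : (H : Subgraph G) → Subgraph.Proper H → ¬ Forcing k (Subgraph.graph H) _
    notForcing H proper (_ , realisesH) with proper⇒missingEdge noIso H proper
    ... | e , e∉H with reach e
    ...   | x , x∈Q , realises-e =
      Q∩R=∅ x x∈Q (proj₂ (realisesH x)
        (realisesOn⇒subgraph H (realisesOn-weaken {G} inH⇒off (deleteEdge⇒off {G} realises-e))))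
      where
      inH⇒off : ∀ e′ → T (Subgraph.inE H e′) → e′ ≢ e
      inH⇒off e′ e′∈H refl = subst T e∉H e′∈H

  module _ {G₁ G₂ : TGraph} where
    private
      off₁ : {e : E G₁} (e′ : E G₁) → e′ ≢ e → inj₁ {B = E G₂} e′ ≢ inj₁ e
      off₁ _ e′≢e = e′≢e ∘ inj₁-injective

      off₁⁻ : {e : E G₁} (e′ : E G₁) → inj₁ {B = E G₂} e′ ≢ inj₁ e → e′ ≢ e
      off₁⁻ _ e′≢e = e′≢e ∘ cong inj₁

      off₂ : {e : E G₂} (e′ : E G₂) → e′ ≢ e → inj₂ {A = E G₁} e′ ≢ inj₂ e
      off₂ _ e′≢e = e′≢e ∘ inj₂-injective

      off₂⁻ : {e : E G₂} (e′ : E G₂) → inj₂ {A = E G₁} e′ ≢ inj₂ e → e′ ≢ e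
      off₂⁻ _ e′≢e = e′≢e ∘ cong inj₂

      nowhere-else₁ : {e : E G₁} (e′ : E G₂) → ⊤ → inj₂ {A = E G₁} e′ ≢ inj₁ e
      nowhere-else₁ _ _ ()

      nowhere-else₂ : {e : E G₂} (e′ : E G₁) → ⊤ → inj₁ {B = E G₂} e′ ≢ inj₂ e
      nowhere-else₂ _ _ ()

    realises-∥⁻ : ∀ {x} → Realises k (G₁ ∥ G₂) x → Realises k G₁ x × Realises k G₂ x
    realises-∥⁻ r with realisesOn-∥⁻ G₁ G₂ (realises⇒everywhere {G₁ ∥ G₂} r)
    ... | r₁ , r₂ = everywhere⇒realises {G₁} r₁ , everywhere⇒realises {G₂} r₂

    realises-∥⁺ : ∀ {x} → Realises k G₁ x → Realises k G₂ x → Realises k (G₁ ∥ G₂) x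
    realises-∥⁺ r₁ r₂ = everywhere⇒realises {G₁ ∥ G₂}
      (realisesOn-∥⁺ G₁ G₂ (realises⇒everywhere {G₁} r₁) (realises⇒everywhere {G₂} r₂))

    deleteEdge-∥ˡ⁻ : ∀ {e x} → Realises k (deleteEdge (G₁ ∥ G₂) (inj₁ e)) x →
                     Realises k (deleteEdge G₁ e) x × Realises k G₂ x
    deleteEdge-∥ˡ⁻ r with realisesOn-∥⁻ G₁ G₂ (deleteEdge⇒off {G₁ ∥ G₂} r)
    ... | r₁ , r₂ = off⇒deleteEdge {G₁} (realisesOn-weaken {G₁} off₁ r₁)
                  , everywhere⇒realises {G₂} (realisesOn-weaken {G₂} nowhere-else₁ r₂)

    deleteEdge-∥ʳ⁻ : ∀ {e x} → Realises k (deleteEdge (G₁ ∥ G₂) (inj₂ e)) x →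
                     Realises k G₁ x × Realises k (deleteEdge G₂ e) x
    deleteEdge-∥ʳ⁻ r with realisesOn-∥⁻ G₁ G₂ (deleteEdge⇒off {G₁ ∥ G₂} r)
    ... | r₁ , r₂ = everywhere⇒realises {G₁} (realisesOn-weaken {G₁} nowhere-else₂ r₁)
                  , off⇒deleteEdge {G₂} (realisesOn-weaken {G₂} off₂ r₂)

    deleteEdge-∥ˡ⁺ : ∀ {e x} → Realises k (deleteEdge G₁ e) x → Realises k G₂ x →
                     Realises k (deleteEdge (G₁ ∥ G₂) (inj₁ e)) x
    deleteEdge-∥ˡ⁺ r₁ r₂ = off⇒deleteEdge {G₁ ∥ G₂} (realisesOn-∥⁺ G₁ G₂
      (realisesOn-weaken {G₁} off₁⁻ (deleteEdge⇒off {G₁} r₁))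
      (realisesOn-weaken {G₂} (λ _ _ → tt) (realises⇒everywhere {G₂} r₂)))

    deleteEdge-∥ʳ⁺ : ∀ {e x} → Realises k G₁ x → Realises k (deleteEdge G₂ e) x →
                     Realises k (deleteEdge (G₁ ∥ G₂) (inj₂ e)) x
    deleteEdge-∥ʳ⁺ r₁ r₂ = off⇒deleteEdge {G₁ ∥ G₂} (realisesOn-∥⁺ G₁ G₂
      (realisesOn-weaken {G₁} (λ _ _ → tt) (realises⇒everywhere {G₁} r₁))
      (realisesOn-weaken {G₂} off₂⁻ (deleteEdge⇒off {G₂} r₂)))

    realises-⊹⁻ : ∀ {z} → Realises k (G₁ ⊹ G₂) z →
                  ∃₂ λ x y → Realises k G₁ x × Realises k G₂ y × z ≡ x ⊕ y
    realises-⊹⁻ r with realisesOn-⊹⁻ G₁ G₂ (realises⇒everywhere {G₁ ⊹ G₂} r)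
    ... | x , y , r₁ , r₂ , z≡x+y = x , y , everywhere⇒realises {G₁} r₁ , everywhere⇒realises {G₂} r₂ , z≡x+y

    realises-⊹⁺ : ∀ {x y} → Realises k G₁ x → Realises k G₂ y → Realises k (G₁ ⊹ G₂) (x ⊕ y)
    realises-⊹⁺ r₁ r₂ = everywhere⇒realises {G₁ ⊹ G₂}
      (realisesOn-⊹⁺ G₁ G₂ (realises⇒everywhere {G₁} r₁) (realises⇒everywhere {G₂} r₂))

    deleteEdge-⊹ˡ⁻ : ∀ {e z} → Realises k (deleteEdge (G₁ ⊹ G₂) (inj₁ e)) z →
                     ∃₂ λ x y → Realises k (deleteEdge G₁ e) x × Realises k G₂ y × z ≡ x ⊕ y
    deleteEdge-⊹ˡ⁻ r with realisesOn-⊹⁻ G₁ G₂ (deleteEdge⇒off {G₁ ⊹ G₂} r)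
    ... | x , y , r₁ , r₂ , z≡x+y = x , y
        , off⇒deleteEdge {G₁} (realisesOn-weaken {G₁} off₁ r₁)
        , everywhere⇒realises {G₂} (realisesOn-weaken {G₂} nowhere-else₁ r₂)
        , z≡x+y

    deleteEdge-⊹ʳ⁻ : ∀ {e z} → Realises k (deleteEdge (G₁ ⊹ G₂) (inj₂ e)) z →
                     ∃₂ λ x y → Realises k G₁ x × Realises k (deleteEdge G₂ e) y × z ≡ x ⊕ y
    deleteEdge-⊹ʳ⁻ r with realisesOn-⊹⁻ G₁ G₂ (deleteEdge⇒off {G₁ ⊹ G₂} r)
    ... | x , y , r₁ , r₂ , z≡x+y = x , y
        , everywhere⇒realises {G₁} (realisesOn-weaken {G₁} nowhere-else₂ r₁)
        , off⇒deleteEdge {G₂} (realisesOn-weaken {G₂} off₂ r₂)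
        , z≡x+y

    deleteEdge-⊹ˡ⁺ : ∀ {e x y} → Realises k (deleteEdge G₁ e) x → Realises k G₂ y →
                     Realises k (deleteEdge (G₁ ⊹ G₂) (inj₁ e)) (x ⊕ y)
    deleteEdge-⊹ˡ⁺ r₁ r₂ = off⇒deleteEdge {G₁ ⊹ G₂} (realisesOn-⊹⁺ G₁ G₂
      (realisesOn-weaken {G₁} off₁⁻ (deleteEdge⇒off {G₁} r₁))
      (realisesOn-weaken {G₂} (λ _ _ → tt) (realises⇒everywhere {G₂} r₂)))

    deleteEdge-⊹ʳ⁺ : ∀ {e x y} → Realises k G₁ x → Realises k (deleteEdge G₂ e) y →
                     Realises k (deleteEdge (G₁ ⊹ G₂) (inj₂ e)) (x ⊕ y)
    deleteEdge-⊹ʳ⁺ r₁ r₂ = off⇒deleteEdge {G₁ ⊹ G₂} (realisesOn-⊹⁺ G₁ G₂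
      (realisesOn-weaken {G₁} (λ _ _ → tt) (realises⇒everywhere {G₁} r₁))
      (realisesOn-weaken {G₂} off₂⁻ (deleteEdge⇒off {G₂} r₂)))

  -- Forced sets

  RealisedSet : TGraph → Subset (suc (k + k)) → Set
  RealisedSet G S = ∀ x → (x ∈ S → Realises k G x) × (Realises k G x → x ∈ S)

  realisedSet-unique : ∀ {G R R′} → RealisedSet G R → RealisedSet G R′ → R ≡ R′
  realisedSet-unique ρ ρ′ = ⊆-antisym (λ {x} x∈R → proj₂ (ρ′ x) (proj₁ (ρ x) x∈R))
                                      (λ {x} x∈R′ → proj₂ (ρ x) (proj₁ (ρ′ x) x∈R′))

  realisedSet-≅ : ∀ {G H R} → G ≅ H → RealisedSet H R → RealisedSet G R
  realisedSet-≅ i ρ x = realises-≅ i ∘ proj₁ (ρ x) , proj₂ (ρ x) ∘ realises-≅ (≅-sym i)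

  realises-negZ : ∀ {G x} → Realises k G x → Realises k G (negZ x)
  realises-negZ ((φ , adj) , φs , φt) = (negZ ∘ φ , Adj-negZ ∘ adj) , trans (cong negZ φs) ε⁻¹≈ε , cong negZ φt

  realisedSet-symmetric : ∀ {G R} → RealisedSet G R → Symmetric R
  realisedSet-symmetric {G} ρ x x∈R = proj₂ (ρ (negZ x)) (realises-negZ {G} (proj₁ (ρ x) x∈R))

  realisedSet-K2 : RealisedSet K2 s1
  realisedSet-K2 x = (λ x∈s1 → ((λ { false → zeroZ ; true → x }) , (λ _ → ∈s1⇒Adj-zero x∈s1)) , refl , refl)
                   , (λ ((φ , adj) , φs , φt) → Adj-zero⇒∈s1 (subst₂ Adj φs φt (adj tt)))

  realisedSet-∥ : ∀ {G₁ G₂ S T} → RealisedSet G₁ S → RealisedSet G₂ T → RealisedSet (G₁ ∥ G₂) (S ∩ T)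
  realisedSet-∥ {S = S} {T} ρ₁ ρ₂ x =
      (λ x∈S∩T → let (x∈S , x∈T) = x∈p∩q⁻ S T x∈S∩T in realises-∥⁺ (proj₁ (ρ₁ x) x∈S) (proj₁ (ρ₂ x) x∈T))
    , (λ r → let (r₁ , r₂) = realises-∥⁻ r in x∈p∩q⁺ (proj₂ (ρ₁ x) r₁ , proj₂ (ρ₂ x) r₂))

  realisedSet-⊹ : ∀ {G₁ G₂ S T} → RealisedSet G₁ S → RealisedSet G₂ T → RealisedSet (G₁ ⊹ G₂) (S ⊞ T)
  realisedSet-⊹ {G₁} {G₂} {S} {T} ρ₁ ρ₂ z =
      (λ z∈S⊞T → let (x , y , x∈S , y∈T , z≡x+y) = ∈-⊞⁻ z∈S⊞T in
        subst (Realises k (G₁ ⊹ G₂)) (sym z≡x+y) (realises-⊹⁺ (proj₁ (ρ₁ x) x∈S) (proj₁ (ρ₂ y) y∈T)))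
    , (λ r → let (x , y , r₁ , r₂ , z≡x+y) = realises-⊹⁻ r in
        subst (_∈ S ⊞ T) (sym z≡x+y) (∈-⊞⁺ (proj₂ (ρ₁ x) r₁) (proj₂ (ρ₂ y) r₂)))

  forced : SPTerm → Subset (suc (k + k))
  forced edge      = s1
  forced (ser a b) = forced a ⊞ forced b
  forced (par a b) = forced a ∩ forced b

  realisedSet-⟦⟧ : ∀ τ → RealisedSet ⟦ τ ⟧ (forced τ)
  realisedSet-⟦⟧ edge      = realisedSet-K2
  realisedSet-⟦⟧ (ser a b) = realisedSet-⊹ (realisedSet-⟦⟧ a) (realisedSet-⟦⟧ b)
  realisedSet-⟦⟧ (par a b) = realisedSet-∥ (realisedSet-⟦⟧ a) (realisedSet-⟦⟧ b)

  forced-symmetric : ∀ τ → Symmetric (forced τ)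
  forced-symmetric τ = realisedSet-symmetric {⟦ τ ⟧} (realisedSet-⟦⟧ τ)

  deletionsReach⇒nonempty : ∀ {G Q} → NoIsolatedVertex G → DeletionsReach G Q → Nonempty Q
  deletionsReach⇒nonempty {G} noIso reach =
    let (e , _) = noIso (s G) ; (x , x∈Q , _) = reach e in x , x∈Q

  deletionsReach-≅ : ∀ {G H Q} → G ≅ H → DeletionsReach H Q → DeletionsReach G Q
  deletionsReach-≅ i reach e = let (x , x∈Q , r) = reach (≅-edge i e) in x , x∈Q , deleteEdge-≅ i r

  module _ {G₁ G₂ : TGraph} {Q S T : Subset (suc (k + k))} where

    deletionsReach-∥ : RealisedSet G₁ S → RealisedSet G₂ T →
                       DeletionsReach G₁ (Q ∩ (T ─ S)) → DeletionsReach G₂ (Q ∩ (S ─ T)) → DeletionsReach (G₁ ∥ G₂) Q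
    deletionsReach-∥ ρ₁ ρ₂ reach₁ reach₂ (inj₁ e) =
      let (x , x∈ , r) = reach₁ e ; (x∈Q , x∈T─S) = x∈p∩q⁻ Q (T ─ S) x∈ in
      x , x∈Q , deleteEdge-∥ˡ⁺ r (proj₁ (ρ₂ x) (p─q⊆p T S x∈T─S))
    deletionsReach-∥ ρ₁ ρ₂ reach₁ reach₂ (inj₂ e) =
      let (x , x∈ , r) = reach₂ e ; (x∈Q , x∈S─T) = x∈p∩q⁻ Q (S ─ T) x∈ in
      x , x∈Q , deleteEdge-∥ʳ⁺ (proj₁ (ρ₁ x) (p─q⊆p S T x∈S─T)) r

    deletionsReach-∥ˡ⁻ : RealisedSet G₂ T → Disjoint Q (S ∩ T) →
                         DeletionsReach (G₁ ∥ G₂) Q → DeletionsReach G₁ (Q ∩ (T ─ S))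
    deletionsReach-∥ˡ⁻ ρ₂ Q∩R=∅ reach e =
      let (x , x∈Q , r) = reach (inj₁ e) ; (r₁ , r₂) = deleteEdge-∥ˡ⁻ r ; x∈T = proj₂ (ρ₂ x) r₂ in
      x , x∈p∩q⁺ (x∈Q , x∈p∧x∉q⇒x∈p─q x∈T (λ x∈S → Q∩R=∅ x x∈Q (x∈p∩q⁺ (x∈S , x∈T)))) , r₁

    deletionsReach-∥ʳ⁻ : RealisedSet G₁ S → Disjoint Q (S ∩ T) →
                         DeletionsReach (G₁ ∥ G₂) Q → DeletionsReach G₂ (Q ∩ (S ─ T))
    deletionsReach-∥ʳ⁻ ρ₁ Q∩R=∅ reach e =
      let (x , x∈Q , r) = reach (inj₂ e) ; (r₁ , r₂) = deleteEdge-∥ʳ⁻ r ; x∈S = proj₂ (ρ₁ x) r₁ in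
      x , x∈p∩q⁺ (x∈Q , x∈p∧x∉q⇒x∈p─q x∈S (λ x∈T → Q∩R=∅ x x∈Q (x∈p∩q⁺ (x∈S , x∈T)))) , r₂

    deletionsReach-⊹ : RealisedSet G₁ S → RealisedSet G₂ T →
                       DeletionsReach G₁ (Q ⟨ T ⟩) → DeletionsReach G₂ (Q ⟨ S ⟩) → DeletionsReach (G₁ ⊹ G₂) Q
    deletionsReach-⊹ ρ₁ ρ₂ reach₁ reach₂ (inj₁ e) =
      let (x , x∈ , r) = reach₁ e ; (y , y∈T , x+y∈Q) = ∈-⟨⟩⁻ {Q} {T} x∈ in
      x ⊕ y , x+y∈Q , deleteEdge-⊹ˡ⁺ r (proj₁ (ρ₂ y) y∈T)
    deletionsReach-⊹ ρ₁ ρ₂ reach₁ reach₂ (inj₂ e) =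
      let (y , y∈ , r) = reach₂ e ; (x , x∈S , y+x∈Q) = ∈-⟨⟩⁻ {Q} {S} y∈ in
      x ⊕ y , subst (_∈ Q) (⊕-comm y x) y+x∈Q , deleteEdge-⊹ʳ⁺ (proj₁ (ρ₁ x) x∈S) r

  deletionsReach-⊹ˡ⁻ : ∀ {G₁ G₂ Q T} → RealisedSet G₂ T →
                       DeletionsReach (G₁ ⊹ G₂) Q → DeletionsReach G₁ (Q ⟨ T ⟩)
  deletionsReach-⊹ˡ⁻ {Q = Q} {T} ρ₂ reach e =
    let (z , z∈Q , r) = reach (inj₁ e) ; (x , y , r₁ , r₂ , z≡x+y) = deleteEdge-⊹ˡ⁻ r in
    x , ∈-⟨⟩⁺ {Q} {T} (proj₂ (ρ₂ y) r₂) (subst (_∈ Q) z≡x+y z∈Q) , r₁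

  deletionsReach-⊹ʳ⁻ : ∀ {G₁ G₂ Q S} → RealisedSet G₁ S →
                       DeletionsReach (G₁ ⊹ G₂) Q → DeletionsReach G₂ (Q ⟨ S ⟩)
  deletionsReach-⊹ʳ⁻ {Q = Q} {S} ρ₁ reach e =
    let (z , z∈Q , r) = reach (inj₂ e) ; (x , y , r₁ , r₂ , z≡x+y) = deleteEdge-⊹ʳ⁻ r in
    y , ∈-⟨⟩⁺ {Q} {S} (proj₂ (ρ₁ x) r₁) (subst (_∈ Q) (trans z≡x+y (⊕-comm x y)) z∈Q) , r₂

  -- The families 𝓕_R^Q

  𝓕-intro : ∀ {G Q R} → SeriesParallel G → Disjoint Q R → Forcing k G R → DeletionsReach G Q → 𝓕 k R Q G
  𝓕-intro sp Q∩R=∅ forcing reach =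
    sp , deletionsReach⇒minForcing (seriesParallel-noIsolatedVertex sp) Q∩R=∅ forcing reach , reach

  𝓕-K2 : ∀ X → Nonempty X → Symmetric X → X ⊆ s̄1 → 𝓕 k s1 X K2
  𝓕-K2 X (x , x∈X) _ X⊆s̄1 =
    𝓕-intro (edge , ≅-refl) (λ y y∈X → x∈∁p⇒x∉p (X⊆s̄1 y∈X)) (s1-nonempty , realisedSet-K2) reach
    where
    s1-nonempty : Nonempty s1
    s1-nonempty = oneZ , x∈p∪q⁺ (inj₁ (x∈⁅x⁆ oneZ))

    reach : DeletionsReach K2 X
    reach tt = x , x∈X , ((λ { false → zeroZ ; true → x }) , (λ (tt , tt≢tt) → ⊥-elim (tt≢tt refl))) , refl , refl

  𝓕-∥ : ∀ Q R → Disjoint Q R → Nonempty Q → Nonempty R → Symmetric Q → Symmetric R →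
        ∀ S T → Symmetric S → Symmetric T → R ≡ S ∩ T →
        Nonempty (Q ∩ (T ─ S)) → Nonempty (Q ∩ (S ─ T)) →
        ∀ G₁ G₂ → 𝓕 k S (Q ∩ (T ─ S)) G₁ → 𝓕 k T (Q ∩ (S ─ T)) G₂ → 𝓕 k R Q (G₁ ∥ G₂)
  𝓕-∥ Q R Q∩R=∅ _ R≢∅ _ _ S T _ _ refl _ _ G₁ G₂
      ((τ₁ , i₁) , ((_ , ρ₁) , _) , reach₁) ((τ₂ , i₂) , ((_ , ρ₂) , _) , reach₂) =
    𝓕-intro (par τ₁ τ₂ , ∥-cong i₁ i₂) Q∩R=∅ (R≢∅ , realisedSet-∥ ρ₁ ρ₂)
            (deletionsReach-∥ ρ₁ ρ₂ reach₁ reach₂)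

  𝓕-⊹ : ∀ Q R → Disjoint Q R → Nonempty Q → Nonempty R → Symmetric Q → Symmetric R →
        ∀ S T → Symmetric S → Symmetric T → R ≡ S ⊞ T →
        Nonempty (Q ⟨ T ⟩) → Nonempty (Q ⟨ S ⟩) →
        ∀ G₁ G₂ → 𝓕 k S (Q ⟨ T ⟩) G₁ → 𝓕 k T (Q ⟨ S ⟩) G₂ → 𝓕 k R Q (G₁ ⊹ G₂)
  𝓕-⊹ Q R Q∩R=∅ _ R≢∅ _ _ S T _ _ refl _ _ G₁ G₂
      ((τ₁ , i₁) , ((_ , ρ₁) , _) , reach₁) ((τ₂ , i₂) , ((_ , ρ₂) , _) , reach₂) =
    𝓕-intro (ser τ₁ τ₂ , ⊹-cong i₁ i₂) Q∩R=∅ (R≢∅ , realisedSet-⊹ ρ₁ ρ₂)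
            (deletionsReach-⊹ ρ₁ ρ₂ reach₁ reach₂)

  𝓕-closed : Closed k (𝓕 k)
  𝓕-closed = 𝓕-K2 , 𝓕-∥ , 𝓕-⊹

  module _ (Φ : Family k) (Φ-closed : Closed k Φ) where
    private
      Φ-K2 = proj₁ Φ-closed
      Φ-∥  = proj₁ (proj₂ Φ-closed)
      Φ-⊹  = proj₂ (proj₂ Φ-closed)

    -- With R = forced τ the equations R ≡ S ∩ T and R ≡ S ⊞ T of the closure conditions hold by refl.
    Φ-forced : ∀ τ Q → Disjoint Q (forced τ) → Nonempty Q → Nonempty (forced τ) → Symmetric Q →
               DeletionsReach ⟦ τ ⟧ Q → Φ (forced τ) Q ⟦ τ ⟧
    Φ-forced edge Q Q∩s1=∅ Q≢∅ _ symQ _ = Φ-K2 Q Q≢∅ symQ (λ x∈Q → x∉p⇒x∈∁p (Q∩s1=∅ _ x∈Q))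
    Φ-forced (par a b) Q Q∩R=∅ Q≢∅ R≢∅ symQ reach =
      Φ-∥ Q R Q∩R=∅ Q≢∅ R≢∅ symQ (forced-symmetric (par a b)) S₁ S₂ (forced-symmetric a) (forced-symmetric b) refl
          Q₁≢∅ Q₂≢∅ ⟦ a ⟧ ⟦ b ⟧
          (Φ-forced a Q₁ (Disjoint-∩─ Q S₁ S₂) Q₁≢∅ (x , proj₁ x∈S₁∩S₂)
             (Symmetric-∩─ symQ (forced-symmetric a) (forced-symmetric b)) reach₁)
          (Φ-forced b Q₂ (Disjoint-∩─ Q S₂ S₁) Q₂≢∅ (x , proj₂ x∈S₁∩S₂)
             (Symmetric-∩─ symQ (forced-symmetric b) (forced-symmetric a)) reach₂)
      where
      S₁ = forced a
      S₂ = forced b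
      R = S₁ ∩ S₂
      Q₁ = Q ∩ (S₂ ─ S₁)
      Q₂ = Q ∩ (S₁ ─ S₂)
      x = proj₁ R≢∅
      x∈S₁∩S₂ = x∈p∩q⁻ S₁ S₂ (proj₂ R≢∅)
      reach₁ : DeletionsReach ⟦ a ⟧ Q₁
      reach₁ = deletionsReach-∥ˡ⁻ {⟦ a ⟧} {⟦ b ⟧} (realisedSet-⟦⟧ b) Q∩R=∅ reach
      reach₂ : DeletionsReach ⟦ b ⟧ Q₂
      reach₂ = deletionsReach-∥ʳ⁻ {⟦ a ⟧} {⟦ b ⟧} (realisedSet-⟦⟧ a) Q∩R=∅ reach
      Q₁≢∅ : Nonempty Q₁
      Q₁≢∅ = deletionsReach⇒nonempty {⟦ a ⟧} (⟦⟧-noIsolatedVertex a) reach₁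
      Q₂≢∅ : Nonempty Q₂
      Q₂≢∅ = deletionsReach⇒nonempty {⟦ b ⟧} (⟦⟧-noIsolatedVertex b) reach₂
    Φ-forced (ser a b) Q Q∩R=∅ Q≢∅ R≢∅ symQ reach =
      Φ-⊹ Q R Q∩R=∅ Q≢∅ R≢∅ symQ (forced-symmetric (ser a b)) S₁ S₂ (forced-symmetric a) (forced-symmetric b) refl
          Q₁≢∅ Q₂≢∅ ⟦ a ⟧ ⟦ b ⟧
          (Φ-forced a Q₁ (Disjoint-⟨⟩ˡ {Q} Q∩R=∅) Q₁≢∅ (x , x∈S₁)
             (Symmetric-⟨⟩ symQ (forced-symmetric b)) reach₁)
          (Φ-forced b Q₂ (Disjoint-⟨⟩ʳ {Q} Q∩R=∅) Q₂≢∅ (y , y∈S₂)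
             (Symmetric-⟨⟩ symQ (forced-symmetric a)) reach₂)
      where
      S₁ = forced a
      S₂ = forced b
      R = S₁ ⊞ S₂
      Q₁ = Q ⟨ S₂ ⟩
      Q₂ = Q ⟨ S₁ ⟩
      summands = ∈-⊞⁻ {S₁} {S₂} (proj₂ R≢∅)
      x = proj₁ summands
      y = proj₁ (proj₂ summands)
      x∈S₁ = proj₁ (proj₂ (proj₂ summands))
      y∈S₂ = proj₁ (proj₂ (proj₂ (proj₂ summands)))
      reach₁ : DeletionsReach ⟦ a ⟧ Q₁
      reach₁ = deletionsReach-⊹ˡ⁻ {⟦ a ⟧} {⟦ b ⟧} (realisedSet-⟦⟧ b) reach
      reach₂ : DeletionsReach ⟦ b ⟧ Q₂
      reach₂ = deletionsReach-⊹ʳ⁻ {⟦ a ⟧} {⟦ b ⟧} (realisedSet-⟦⟧ a) reach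
      Q₁≢∅ : Nonempty Q₁
      Q₁≢∅ = deletionsReach⇒nonempty {⟦ a ⟧} (⟦⟧-noIsolatedVertex a) reach₁
      Q₂≢∅ : Nonempty Q₂
      Q₂≢∅ = deletionsReach⇒nonempty {⟦ b ⟧} (⟦⟧-noIsolatedVertex b) reach₂

    𝓕⊆Φ : IsoInvariant k Φ → Contains𝓕 k Φ
    𝓕⊆Φ Φ-iso R Q Q∩R=∅ Q≢∅ R≢∅ symQ _ G ((τ , i) , ((_ , ρ) , _) , reach) =
      Φ-iso R Q ⟦ τ ⟧ G i (subst (λ R′ → Φ R′ Q ⟦ τ ⟧) (sym R≡forced)
        (Φ-forced τ Q (subst (Disjoint Q) R≡forced Q∩R=∅) Q≢∅ (subst Nonempty R≡forced R≢∅) symQ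
          (deletionsReach-≅ i reach)))
      where
      R≡forced : R ≡ forced τ
      R≡forced = realisedSet-unique {⟦ τ ⟧} (realisedSet-≅ i ρ) (realisedSet-⟦⟧ τ)

lemma4p6 : (k : ℕ) → 2 ≤ k →
    Closed k (𝓕 k) × ((Φ : Family k) → IsoInvariant k Φ → Closed k Φ → Contains𝓕 k Φ)
lemma4p6 k _ = 𝓕-closed , λ Φ Φ-iso Φ-closed → 𝓕⊆Φ Φ Φ-closed Φ-iso
  where open Colourings k
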